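{- In the buffer management problem with packet values $v_1<\dots<v_m$, exactly one queue per value, and all queues of common capacity $B$, fix any input sequence $\sigma$. For each $j$, let $A_j$ and $A^*_j$ be the numbers of $v_j$-packets accepted on $\sigma$ by GREEDY and by an optimal (diligent) offline algorithm OPT, respectively. Then $$\sum_{j=1}^{m-1} v_j\left(A^*_j-A_j\right)\le \sum_{j=1}^{m-1} v_j A_{j+1}.$$
   Context: Model: packets arrive over time (at non-integral times) with non-negative values in $\{v_1<\dots<v_m\}$; a $v_i$-packet goes to the unique $v_i$-queue, which holds at most $B$ packets, and is either admitted (only if there is room) or rejected. At the end of each unit time step (send event) at most one packet from a non-empty queue is transmitted. Benefit is the total value of transmitted packets. OPT is an offline algorithm maximizing the benefit; it is diligent, i.e., it accepts every packet whose queue has room and sends a packet whenever some queue is non-empty. GREEDY accepts every packet whose queue is not full and at each send event sends from the non-empty queue of highest value.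
   Formalization: The packet values $v_1<\dots<v_m$ are non-negative rationals. -}

module Defs where

open import Data.Nat as ℕ using (ℕ; zero; suc; _∸_; _<ᵇ_)
open import Data.Fin as Fin using (Fin; fromℕ; inject₁)
open import Data.Fin.Properties using (_≟_)
open import Data.Bool using (Bool; true; false; if_then_else_)
open import Data.Maybe using (Maybe; just; nothing; maybe)
import Data.Maybe as Maybe
open import Data.List using (List; []; _∷_)
open import Data.Product using (_×_)
open import Data.Unit using (⊤)
open import Data.Empty using (⊥)
open import Data.Integer using (+_)
open import Data.Rational using (ℚ; 0ℚ; _+_; _*_; _/_)
open import Relation.Binary.PropositionalEquality using (_≡_)
open import Relation.Nullary using (yes; no)

-- Arrivals happen at
-- non-integral times, so between two consecutive send events there is a
-- (possibly empty) list of arrivals;  `arr j` is the arrival of a packet of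
-- value v_j (queue j), `snd` is a send event (end of a unit time step).
data Event (m : ℕ) : Set where
  arr : Fin m → Event m
  snd : Event m

data Dec (m : ℕ) : Set where
  accept   : Dec m
  reject   : Dec m
  sendFrom : Fin m → Dec m
  idle     : Dec m

Loads : ℕ → Set
Loads m = Fin m → ℕ

empty : ∀ {m} → Loads m
empty _ = 0

update : ∀ {m} → Loads m → Fin m → (ℕ → ℕ) → Loads m
update q j f k with k ≟ j
... | yes _ = f (q k)
... | no  _ = q k

step : ∀ {m} → Loads m → Event m → Dec m → Loads m
step q (arr j) accept       = update q j suc
step q snd     (sendFrom i) = update q i (λ x → x ∸ 1)
step q _       _            = q

Ok : ∀ {m} → ℕ → Loads m → Event m → Dec m → Set
Ok B q (arr j) accept       = q j ℕ.< B
Ok B q (arr j) reject       = ⊤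
Ok B q snd     (sendFrom i) = 0 ℕ.< q i
Ok B q snd     idle         = ⊤
Ok B q _       _            = ⊥

Feasible : ∀ {m} → ℕ → Loads m → List (Event m) → List (Dec m) → Set
Feasible B q []       []       = ⊤
Feasible B q (e ∷ es) (d ∷ ds) = Ok B q e d × Feasible B (step q e d) es ds
Feasible B q _        _        = ⊥

DilOk : ∀ {m} → ℕ → Loads m → Event m → Dec m → Set
DilOk B q (arr j) reject = B ℕ.≤ q j
DilOk B q snd     idle   = ∀ i → q i ≡ 0
DilOk B q _       _      = ⊤

Diligent : ∀ {m} → ℕ → Loads m → List (Event m) → List (Dec m) → Set
Diligent B q []       []       = ⊤
Diligent B q (e ∷ es) (d ∷ ds) = DilOk B q e d × Diligent B (step q e d) es ds
Diligent B q _        _        = ⊥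

highest : ∀ {m} → Loads m → Maybe (Fin m)
highest {zero}  q = nothing
highest {suc m} q with q (fromℕ m)
... | suc _ = just (fromℕ m)
... | zero  = Maybe.map inject₁ (highest (λ k → q (inject₁ k)))

greedy : ∀ {m} → ℕ → Loads m → List (Event m) → List (Dec m)
greedy B q []            = []
greedy B q (arr j ∷ es)  =
  let d = if q j <ᵇ B then accept else reject in d ∷ greedy B (step q (arr j) d) es
greedy B q (snd ∷ es)    =
  let d = maybe sendFrom idle (highest q) in d ∷ greedy B (step q snd d) es

final : ∀ {m} → Loads m → List (Event m) → List (Dec m) → Loads m
final q (e ∷ es) (d ∷ ds) = final (step q e d) es ds
final q _        _        = q

accepted : ∀ {m} → Fin m → List (Event m) → List (Dec m) → ℕ
accepted j (arr k ∷ es) (accept ∷ ds) with k ≟ j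
... | yes _ = suc (accepted j es ds)
... | no  _ = accepted j es ds
accepted j (_ ∷ es) (_ ∷ ds) = accepted j es ds
accepted j _ _ = 0

toℚ : ℕ → ℚ
toℚ n = + n / 1

Σ : ∀ n → (Fin n → ℚ) → ℚ
Σ zero    f = 0ℚ
Σ (suc n) f = f Fin.zero + Σ n (λ i → f (Fin.suc i))

sentValue : ∀ {m} → (Fin m → ℚ) → List (Event m) → List (Dec m) → ℚ
sentValue v (snd ∷ es) (sendFrom i ∷ ds) = v i + sentValue v es ds
sentValue v (_ ∷ es) (_ ∷ ds) = sentValue v es ds
sentValue v _ _ = 0ℚ

-- After σ only
-- send events follow (infinitely many), so every packet still buffered at
-- the end of σ is eventually transmitted by an optimal continuation; the
-- benefit therefore is the value sent during σ plus the value left buffered.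
benefit : ∀ {m} → (Fin m → ℚ) → List (Event m) → List (Dec m) → ℚ
benefit {m} v σ ds = sentValue v σ ds + Σ m (λ i → v i * toℚ (final empty σ ds i))

-- Let g and o be the queue loads of GREEDY and of any feasible schedule, and weight queue j by
-- α j = v j (but 0 on the top queue) and β j = v (j - 1) (but 0 on the bottom queue), so that
-- α a ≤ β h whenever a < h.  With the potential
--   Φ (g , o) = Σ_j α j (g j ∸ o j) + β j g j
-- every event satisfies
--   Φ (g′ , o′) + (α-value admitted by the schedule) ≤ Φ (g , o) + ((α + β)-value admitted by GREEDY):
-- an arrival touches a single queue, where this is a comparison of natural numbers; when the two
-- send from different queues a and h, the drop β h of Φ at GREEDY's queue h pays for the rise of
-- at most α a at queue a, which happens only if g a > 0, and then a < h by the choice of h.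
-- Summing over the events, with Φ = 0 at the start and Φ ≥ 0 at the end,
-- Σ_j α j A*_j ≤ Σ_j (α j + β j) A_j, which is the claim.

module Submission where

open import Defs
open import Data.Nat using (ℕ; suc)
open import Data.Fin using (Fin; inject₁) renaming (suc to fsuc; _<_ to _<ᶠ_)
open import Data.List using (List)
open import Data.Rational using (ℚ; 0ℚ; _≤_; _<_; _*_; _-_)

open import Algebra.Bundles using (CommutativeMonoid)
open import Data.Bool using (true; false; if_then_else_)
open import Data.Fin using (fromℕ; toℕ) renaming (zero to fzero; _≤_ to _≤ᶠ_)
import Data.Fin.Properties as Finₚ
open import Data.Fin.Relation.Unary.Top using (view; ‵fromℕ; ‵inject₁)
import Data.Integer as ℤ
import Data.Integer.Properties as ℤₚ
open import Data.List using ([]; _∷_)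
open import Data.Maybe using (Maybe; just; nothing)
import Data.Maybe as Maybe
import Data.Nat as ℕ
import Data.Nat.Coprimality as Coprimality
import Data.Nat.Properties as ℕₚ
open import Data.Product using (_×_; _,_)
open import Data.Rational using (1ℚ; _+_; -_; toℚᵘ)
import Data.Rational as ℚ
import Data.Rational.Properties as ℚₚ
import Data.Rational.Unnormalised as ℚᵘ
import Data.Rational.Unnormalised.Properties as ℚᵘₚ
open import Data.Sum using (inj₁; inj₂)
open import Function using (_∘_)
open import Relation.Binary.PropositionalEquality
open import Relation.Nullary using (yes; no; contradiction)
open import Relation.Nullary.Decidable using (dec⇒maybe)
open import Relation.Nullary.Reflects using (ofⁿ)
open import Tactic.RingSolver using (solve-∀)
open import Tactic.RingSolver.Core.AlmostCommutativeRing using (AlmostCommutativeRing; fromCommutativeRing)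
open import Level using (0ℓ)

open import Algebra.Properties.CommutativeSemigroup
  (CommutativeMonoid.commutativeSemigroup ℚₚ.+-0-commutativeMonoid)
  using (interchange; x∙yz≈y∙xz; x∙yz≈yx∙z; xy∙z≈xz∙y)
open import Algebra.Properties.Group ℚₚ.+-0-group using (//-rightDividesˡ; //-rightDividesʳ)

ℚ-ring : AlmostCommutativeRing 0ℓ 0ℓ
ℚ-ring = fromCommutativeRing ℚₚ.+-*-commutativeRing (λ x → dec⇒maybe (0ℚ ℚₚ.≟ x))

toℚᵘ-toℚ : ∀ x → toℚᵘ (toℚ x) ≡ ℚᵘ.mkℚᵘ (ℤ.+ x) 0
toℚᵘ-toℚ x = cong toℚᵘ (ℚₚ.normalize-coprime (Coprimality.sym (Coprimality.1-coprimeTo x)))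

toℚ-+ : ∀ x y → toℚ (x ℕ.+ y) ≡ toℚ x + toℚ y
toℚ-+ x y = ℚₚ.toℚᵘ-injective (begin
  toℚᵘ (toℚ (x ℕ.+ y))                         ≡⟨ toℚᵘ-toℚ (x ℕ.+ y) ⟩
  ℚᵘ.mkℚᵘ (ℤ.+ (x ℕ.+ y)) 0                      ≈⟨ ℚᵘ.*≡* numerators ⟩
  ℚᵘ.mkℚᵘ (ℤ.+ x) 0 ℚᵘ.+ ℚᵘ.mkℚᵘ (ℤ.+ y) 0         ≡⟨ cong₂ ℚᵘ._+_ (toℚᵘ-toℚ x) (toℚᵘ-toℚ y) ⟨
  toℚᵘ (toℚ x) ℚᵘ.+ toℚᵘ (toℚ y)               ≈⟨ ℚₚ.toℚᵘ-homo-+ (toℚ x) (toℚ y) ⟨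
  toℚᵘ (toℚ x + toℚ y)                         ∎)
  where
  open ℚᵘₚ.≃-Reasoning
  numerators : ℤ.+ (x ℕ.+ y) ℤ.* ℤ.+ 1 ≡ (ℤ.+ x ℤ.* ℤ.+ 1 ℤ.+ ℤ.+ y ℤ.* ℤ.+ 1) ℤ.* ℤ.+ 1
  numerators = trans (ℤₚ.*-identityʳ _) (trans (ℤₚ.pos-+ x y) (sym (trans (ℤₚ.*-identityʳ _)
    (cong₂ ℤ._+_ (ℤₚ.*-identityʳ (ℤ.+ x)) (ℤₚ.*-identityʳ (ℤ.+ y))))))

open ℚₚ.≤-Reasoning

toℚ-nonNeg : ∀ x → 0ℚ ≤ toℚ x
toℚ-nonNeg x = ℚₚ.nonNegative⁻¹ (toℚ x) {{ℚₚ.normalize-nonNeg x 1}}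

toℚ-mono-≤ : ∀ {x y} → x ℕ.≤ y → toℚ x ≤ toℚ y
toℚ-mono-≤ {x} {y} x≤y = begin
  toℚ x                    ≡⟨ ℚₚ.+-identityʳ (toℚ x) ⟨
  toℚ x + 0ℚ               ≤⟨ ℚₚ.+-monoʳ-≤ (toℚ x) (toℚ-nonNeg (y ℕ.∸ x)) ⟩
  toℚ x + toℚ (y ℕ.∸ x)    ≡⟨ toℚ-+ x (y ℕ.∸ x) ⟨
  toℚ (x ℕ.+ (y ℕ.∸ x))    ≡⟨ cong toℚ (ℕₚ.m+[n∸m]≡n x≤y) ⟩
  toℚ y                    ∎

+-cancelʳ-≤ : ∀ {p q} r → p + r ≤ q + r → p ≤ q
+-cancelʳ-≤ {p} {q} r p+r≤q+r = begin
  p              ≡⟨ //-rightDividesʳ r p ⟨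
  p + r - r      ≤⟨ ℚₚ.+-monoˡ-≤ (- r) p+r≤q+r ⟩
  q + r - r      ≡⟨ //-rightDividesʳ r q ⟩
  q              ∎

Σ-cong : ∀ m {f g : Fin m → ℚ} → (∀ j → f j ≡ g j) → Σ m f ≡ Σ m g
Σ-cong ℕ.zero    f≗g = refl
Σ-cong (suc m) f≗g = cong₂ _+_ (f≗g fzero) (Σ-cong m (f≗g ∘ fsuc))

Σ-distrib-+ : ∀ m (f g : Fin m → ℚ) → Σ m (λ j → f j + g j) ≡ Σ m f + Σ m g
Σ-distrib-+ ℕ.zero    f g = refl
Σ-distrib-+ (suc m) f g = trans (cong ((f fzero + g fzero) +_) (Σ-distrib-+ m (f ∘ fsuc) (g ∘ fsuc)))
  (interchange (f fzero) (g fzero) (Σ m (f ∘ fsuc)) (Σ m (g ∘ fsuc)))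

Σ-zero : ∀ m → Σ m (λ _ → 0ℚ) ≡ 0ℚ
Σ-zero ℕ.zero    = refl
Σ-zero (suc m) = cong (0ℚ +_) (Σ-zero m)

Σ-mono-≤ : ∀ m {f g : Fin m → ℚ} → (∀ j → f j ≤ g j) → Σ m f ≤ Σ m g
Σ-mono-≤ ℕ.zero    f≤g = ℚₚ.≤-refl
Σ-mono-≤ (suc m) f≤g = ℚₚ.+-mono-≤ (f≤g fzero) (Σ-mono-≤ m (f≤g ∘ fsuc))

Σ-mono-≤-except : ∀ m {f g : Fin m → ℚ} (k : Fin m) {c c′ : ℚ} →
                  (∀ j → j ≢ k → f j ≤ g j) → f k + c ≤ g k + c′ → Σ m f + c ≤ Σ m g + c′
Σ-mono-≤-except (suc m) {f} {g} fzero {c} {c′} f≤g fk≤gk = begin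
  f fzero + Σ m (f ∘ fsuc) + c     ≡⟨ xy∙z≈xz∙y (f fzero) _ c ⟩
  f fzero + c + Σ m (f ∘ fsuc)     ≤⟨ ℚₚ.+-mono-≤ fk≤gk (Σ-mono-≤ m (λ j → f≤g (fsuc j) λ ())) ⟩
  g fzero + c′ + Σ m (g ∘ fsuc)    ≡⟨ xy∙z≈xz∙y (g fzero) _ c′ ⟨
  g fzero + Σ m (g ∘ fsuc) + c′    ∎
Σ-mono-≤-except (suc m) {f} {g} (fsuc k) {c} {c′} f≤g fk≤gk = begin
  f fzero + Σ m (f ∘ fsuc) + c     ≡⟨ ℚₚ.+-assoc (f fzero) _ c ⟩
  f fzero + (Σ m (f ∘ fsuc) + c)   ≤⟨ ℚₚ.+-mono-≤ (f≤g fzero λ ()) (Σ-mono-≤-except m k f≤g-off-k fk≤gk) ⟩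
  g fzero + (Σ m (g ∘ fsuc) + c′)  ≡⟨ ℚₚ.+-assoc (g fzero) _ c′ ⟨
  g fzero + Σ m (g ∘ fsuc) + c′    ∎
  where
  f≤g-off-k : ∀ j → j ≢ k → f (fsuc j) ≤ g (fsuc j)
  f≤g-off-k j j≢k = f≤g (fsuc j) (j≢k ∘ Finₚ.suc-injective)

Σ[f*[a-b]]+Σ[f*b]≡Σ[f*a] : ∀ n (f a b : Fin n → ℚ) →
  Σ n (λ j → f j * (a j - b j)) + Σ n (λ j → f j * b j) ≡ Σ n (λ j → f j * a j)
Σ[f*[a-b]]+Σ[f*b]≡Σ[f*a] n f a b = trans (sym (Σ-distrib-+ n _ _)) (Σ-cong n λ j →
  trans (sym (ℚₚ.*-distribˡ-+ (f j) _ (b j))) (cong (f j *_) (//-rightDividesˡ (b j) (a j))))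

Σ-inject₁ : ∀ n (f : Fin (suc n) → ℚ) → f (fromℕ n) ≡ 0ℚ → Σ (suc n) f ≡ Σ n (f ∘ inject₁)
Σ-inject₁ ℕ.zero    f f₀≡0 = cong (_+ 0ℚ) f₀≡0
Σ-inject₁ (suc n) f fₙ≡0 = cong (f fzero +_) (Σ-inject₁ n (f ∘ fsuc) fₙ≡0)

-- Queue loads and the greedy schedule

module _ {m : ℕ} where

  update-≡ : ∀ (q : Loads m) k f → update q k f k ≡ f (q k)
  update-≡ q k f with k Finₚ.≟ k
  ... | yes _   = refl
  ... | no k≢k  = contradiction refl k≢k

  update-≢ : ∀ (q : Loads m) {k j} f → j ≢ k → update q k f j ≡ q j
  update-≢ q {k} {j} f j≢k with j Finₚ.≟ k
  ... | yes j≡k = contradiction j≡k j≢k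
  ... | no _    = refl

  update-≤ : ∀ (q : Loads m) k {f} → (∀ x → f x ℕ.≤ x) → ∀ j → update q k f j ℕ.≤ q j
  update-≤ q k {f} f≤id j with j Finₚ.≟ k
  ... | yes _ = f≤id (q j)
  ... | no _  = ℕₚ.≤-refl

  data Highest (q : Loads m) : Maybe (Fin m) → Set where
    none : (∀ k → q k ≡ 0) → Highest q nothing
    some : ∀ {h} → 0 ℕ.< q h → (∀ k → 0 ℕ.< q k → k ≤ᶠ h) → Highest q (just h)

highest-correct : ∀ {m} (q : Loads m) → Highest q (highest q)
highest-correct {ℕ.zero} q = none λ ()
highest-correct {suc m}  q with q (fromℕ m) in qₘ≡
... | suc _   = some (subst (0 ℕ.<_) (sym qₘ≡) ℕ.z<s) (λ k _ → Finₚ.≤fromℕ k)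
... | ℕ.zero  = lift (highest-correct (q ∘ inject₁))
  where
  lift : ∀ {h} → Highest (q ∘ inject₁) h → Highest q (Maybe.map inject₁ h)
  lift (none q′≡0) = none allZero
    where
    allZero : ∀ k → q k ≡ 0
    allZero k with view k
    ... | ‵fromℕ      = qₘ≡
    ... | ‵inject₁ k′ = q′≡0 k′
  lift (some {h} pos max) = some pos bounded
    where
    bounded : ∀ k → 0 ℕ.< q k → k ≤ᶠ inject₁ h
    bounded k qₖ>0 with view k
    ... | ‵fromℕ      = contradiction qₘ≡ (ℕₚ.>⇒≢ qₖ>0)
    ... | ‵inject₁ k′ = subst₂ ℕ._≤_ (sym (Finₚ.toℕ-inject₁ k′)) (sym (Finₚ.toℕ-inject₁ h)) (max k′ qₖ>0)

greedyChoice : ∀ {m} → ℕ → Loads m → Event m → Dec m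
greedyChoice B q (arr j) = if q j ℕ.<ᵇ B then accept else reject
greedyChoice B q snd     = Maybe.maybe sendFrom idle (highest q)

greedy-∷ : ∀ {m} B (q : Loads m) e es →
           greedy B q (e ∷ es) ≡ greedyChoice B q e ∷ greedy B (step q e (greedyChoice B q e)) es
greedy-∷ B q (arr j) es = refl
greedy-∷ B q snd     es = refl

admitted : ∀ {m} → Event m → Dec m → Loads m
admitted (arr k) accept = update empty k suc
admitted _       _      = empty

accepts : ∀ {m} → List (Event m) → List (Dec m) → Loads m
accepts es ds j = accepted j es ds

accepts-∷ : ∀ {m} e d (es : List (Event m)) ds j →
            accepts (e ∷ es) (d ∷ ds) j ≡ admitted e d j ℕ.+ accepts es ds j
accepts-∷ (arr k) accept es ds j with k Finₚ.≟ j
... | yes refl = cong (ℕ._+ accepted k es ds) (sym (update-≡ empty k suc))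
... | no k≢j   = cong (ℕ._+ accepted j es ds) (sym (update-≢ empty suc (k≢j ∘ sym)))
accepts-∷ (arr k) reject       es ds j = refl
accepts-∷ (arr k) (sendFrom _) es ds j = refl
accepts-∷ (arr k) idle         es ds j = refl
accepts-∷ snd     d            es ds j = refl

suc-∸-≤ : ∀ x y → suc x ℕ.∸ y ℕ.≤ suc (x ℕ.∸ y)
suc-∸-≤ x       ℕ.zero    = ℕₚ.≤-refl
suc-∸-≤ ℕ.zero  (suc y) = ℕₚ.≤-trans (ℕₚ.≤-reflexive (ℕₚ.0∸n≡0 y)) ℕ.z≤n
suc-∸-≤ (suc x) (suc y) = suc-∸-≤ x y

∸-pred-≤ : ∀ x y → x ℕ.∸ (y ℕ.∸ 1) ℕ.≤ suc (x ℕ.∸ y)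
∸-pred-≤ x       ℕ.zero    = ℕₚ.n≤1+n x
∸-pred-≤ ℕ.zero  (suc y) = ℕₚ.≤-trans (ℕₚ.≤-reflexive (ℕₚ.0∸n≡0 y)) ℕ.z≤n
∸-pred-≤ (suc x) (suc y) = suc-∸-≤ x y

pred-∸-pred : ∀ x y → 0 ℕ.< y → (x ℕ.∸ 1) ℕ.∸ (y ℕ.∸ 1) ≡ x ℕ.∸ y
pred-∸-pred x (suc y) _ = ℕₚ.∸-+-assoc x 1 y

module WeightedCounts {m : ℕ} (α β : Fin m → ℚ) (α≥0 : ∀ k → 0ℚ ≤ α k) (β≥0 : ∀ k → 0ℚ ≤ β k) where

  weight : Fin m → ℕ → ℕ → ℚ
  weight k u w = α k * toℚ u + β k * toℚ w

  value : Loads m → Loads m → ℚ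
  value u w = Σ m (λ k → weight k (u k) (w k))

  weight-+ : ∀ k u w u′ w′ → weight k (u ℕ.+ u′) (w ℕ.+ w′) ≡ weight k u w + weight k u′ w′
  weight-+ k u w u′ w′ rewrite toℚ-+ u u′ | toℚ-+ w w′ = distrib (α k) (β k) (toℚ u) (toℚ w) (toℚ u′) (toℚ w′)
    where
    distrib : ∀ a b x y x′ y′ → a * (x + x′) + b * (y + y′) ≡ (a * x + b * y) + (a * x′ + b * y′)
    distrib = solve-∀ ℚ-ring

  weight-sucˡ : ∀ k u w → weight k (suc u) w ≡ weight k u w + α k
  weight-sucˡ k u w = trans (cong (λ t → α k * t + β k * toℚ w) (toℚ-+ 1 u)) (unit (α k) (β k) (toℚ u) (toℚ w))
    where
    unit : ∀ a b x y → a * (1ℚ + x) + b * y ≡ (a * x + b * y) + a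
    unit = solve-∀ ℚ-ring

  weight-sucʳ : ∀ k u w → weight k u (suc w) ≡ weight k u w + β k
  weight-sucʳ k u w = trans (cong (λ t → α k * toℚ u + β k * t) (toℚ-+ 1 w)) (unit (α k) (β k) (toℚ u) (toℚ w))
    where
    unit : ∀ a b x y → a * x + b * (1ℚ + y) ≡ (a * x + b * y) + b
    unit = solve-∀ ℚ-ring

  weight-zero : ∀ k → weight k 0 0 ≡ 0ℚ
  weight-zero k = annihilate (α k) (β k)
    where
    annihilate : ∀ a b → a * 0ℚ + b * 0ℚ ≡ 0ℚ
    annihilate = solve-∀ ℚ-ring

  weight-mono-≤ : ∀ k {u u′ w w′} → u ℕ.≤ u′ → w ℕ.≤ w′ → weight k u w ≤ weight k u′ w′
  weight-mono-≤ k u≤u′ w≤w′ = ℚₚ.+-mono-≤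
    (ℚₚ.*-monoˡ-≤-nonNeg (α k) {{ℚ.nonNegative (α≥0 k)}} (toℚ-mono-≤ u≤u′))
    (ℚₚ.*-monoˡ-≤-nonNeg (β k) {{ℚ.nonNegative (β≥0 k)}} (toℚ-mono-≤ w≤w′))

  value-cong : ∀ {u u′ w w′} → (∀ j → u j ≡ u′ j) → (∀ j → w j ≡ w′ j) → value u w ≡ value u′ w′
  value-cong u≗u′ w≗w′ = Σ-cong m (λ k → cong₂ (weight k) (u≗u′ k) (w≗w′ k))

  value-+ : ∀ u w u′ w′ → value u w + value u′ w′ ≡ value (λ j → u j ℕ.+ u′ j) (λ j → w j ℕ.+ w′ j)
  value-+ u w u′ w′ = sym (trans (Σ-cong m (λ k → weight-+ k (u k) (w k) (u′ k) (w′ k))) (Σ-distrib-+ m _ _))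

  value-zero : value empty empty ≡ 0ℚ
  value-zero = trans (Σ-cong m weight-zero) (Σ-zero m)

  Dominated : Loads m → Loads m → Loads m → Loads m → Fin m → Set
  Dominated u w u′ w′ j = u j ℕ.≤ u′ j × w j ℕ.≤ w′ j

  value-mono-≤ : ∀ {u w u′ w′} → (∀ j → Dominated u w u′ w′ j) → value u w ≤ value u′ w′
  value-mono-≤ dom = Σ-mono-≤ m λ k → let (u≤u′ , w≤w′) = dom k in weight-mono-≤ k u≤u′ w≤w′

  value-mono-≤-except : ∀ {u w u′ w′} k {c c′} → (∀ j → j ≢ k → Dominated u w u′ w′ j) →
                        weight k (u k) (w k) + c ≤ weight k (u′ k) (w′ k) + c′ →
                        value u w + c ≤ value u′ w′ + c′
  value-mono-≤-except k dom = Σ-mono-≤-except m k λ j j≢k →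
    let (u≤u′ , w≤w′) = dom j j≢k in weight-mono-≤ j u≤u′ w≤w′

  value-nonNeg : ∀ u w → 0ℚ ≤ value u w
  value-nonNeg u w = begin
    0ℚ                 ≡⟨ value-zero ⟨
    value empty empty  ≤⟨ value-mono-≤ {u′ = u} {w′ = w} (λ _ → ℕ.z≤n , ℕ.z≤n) ⟩
    value u w          ∎

-- The potential argument

module GreedyPotential (B : ℕ) {m : ℕ} (α β : Fin m → ℚ)
  (α≥0 : ∀ k → 0ℚ ≤ α k) (β≥0 : ∀ k → 0ℚ ≤ β k) (α≤β : ∀ a h → a <ᶠ h → α a ≤ β h) where

  open WeightedCounts α β α≥0 β≥0

  potential : Loads m → Loads m → ℚ
  potential g o = value (λ k → g k ℕ.∸ o k) g

  arrival-step : ∀ g o k d → Ok B o (arr k) d →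
    let d* = greedyChoice B g (arr k) ; g′ = step g (arr k) d* ; o′ = step o (arr k) d in
    value (λ j → admitted (arr k) d j ℕ.+ (g′ j ℕ.∸ o′ j)) g′
      ≤ value (λ j → admitted (arr k) d* j ℕ.+ (g j ℕ.∸ o j)) (λ j → admitted (arr k) d* j ℕ.+ g j)
  arrival-step g o k accept oₖ<B with g k ℕ.<ᵇ B | ℕₚ.<ᵇ-reflects-< (g k) B
  ... | true  | _ = value-mono-≤ both
    where
    both : ∀ j → Dominated (λ j → update empty k suc j ℕ.+ (update g k suc j ℕ.∸ update o k suc j)) (update g k suc)
                           (λ j → update empty k suc j ℕ.+ (g j ℕ.∸ o j)) (λ j → update empty k suc j ℕ.+ g j) j
    both j with j Finₚ.≟ k
    ... | yes refl = ℕₚ.≤-refl , ℕₚ.≤-refl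
    ... | no _     = ℕₚ.≤-refl , ℕₚ.≤-refl
  ... | false | ofⁿ gₖ≮B = value-mono-≤ onlyOther
    where
    onlyOther : ∀ j → Dominated (λ j → update empty k suc j ℕ.+ (g j ℕ.∸ update o k suc j)) g
                                (λ j → g j ℕ.∸ o j) g j
    onlyOther j with j Finₚ.≟ k
    ... | yes refl = ℕₚ.≤-reflexive (sym (ℕₚ.+-∸-assoc 1 (ℕₚ.<-≤-trans oₖ<B (ℕₚ.≮⇒≥ gₖ≮B)))) , ℕₚ.≤-refl
    ... | no _     = ℕₚ.≤-refl , ℕₚ.≤-refl
  arrival-step g o k reject _ with g k ℕ.<ᵇ B
  ... | true  = value-mono-≤ onlyGreedy
    where
    onlyGreedy : ∀ j → Dominated (λ j → update g k suc j ℕ.∸ o j) (update g k suc)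
                                 (λ j → update empty k suc j ℕ.+ (g j ℕ.∸ o j)) (λ j → update empty k suc j ℕ.+ g j) j
    onlyGreedy j with j Finₚ.≟ k
    ... | yes refl = suc-∸-≤ (g k) (o k) , ℕₚ.≤-refl
    ... | no _     = ℕₚ.≤-refl , ℕₚ.≤-refl
  ... | false = ℚₚ.≤-refl

  weight-send-other : ∀ k x y {c} → 0ℚ ≤ c → (0 ℕ.< x → α k ≤ c) →
                      weight k (x ℕ.∸ (y ℕ.∸ 1)) x + 0ℚ ≤ weight k (x ℕ.∸ y) x + c
  weight-send-other k ℕ.zero y c≥0 _ = ℚₚ.+-mono-≤
    (weight-mono-≤ k (ℕₚ.≤-trans (ℕₚ.≤-reflexive (ℕₚ.0∸n≡0 (y ℕ.∸ 1))) (ℕ.z≤n {0 ℕ.∸ y})) (ℕₚ.≤-refl {0})) c≥0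
  weight-send-other k x@(suc _) y {c} _ αₖ≤c = begin
    weight k (x ℕ.∸ (y ℕ.∸ 1)) x + 0ℚ  ≡⟨ ℚₚ.+-identityʳ _ ⟩
    weight k (x ℕ.∸ (y ℕ.∸ 1)) x       ≤⟨ weight-mono-≤ k (∸-pred-≤ x y) (ℕₚ.≤-refl {x}) ⟩
    weight k (suc (x ℕ.∸ y)) x         ≡⟨ weight-sucˡ k (x ℕ.∸ y) x ⟩
    weight k (x ℕ.∸ y) x + α k         ≤⟨ ℚₚ.+-monoʳ-≤ (weight k (x ℕ.∸ y) x) (αₖ≤c ℕ.z<s) ⟩
    weight k (x ℕ.∸ y) x + c           ∎

  weight-send-greedy : ∀ k x y → 0 ℕ.< x → weight k ((x ℕ.∸ 1) ℕ.∸ y) (x ℕ.∸ 1) + β k ≤ weight k (x ℕ.∸ y) x + 0ℚ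
  weight-send-greedy k (suc x) y _ = begin
    weight k (x ℕ.∸ y) x + β k        ≡⟨ weight-sucʳ k (x ℕ.∸ y) x ⟨
    weight k (x ℕ.∸ y) (suc x)        ≤⟨ weight-mono-≤ k (ℕₚ.∸-monoˡ-≤ y (ℕₚ.n≤1+n x)) (ℕₚ.≤-refl {suc x}) ⟩
    weight k (suc x ℕ.∸ y) (suc x)    ≡⟨ ℚₚ.+-identityʳ _ ⟨
    weight k (suc x ℕ.∸ y) (suc x) + 0ℚ  ∎

  potential-transfer : ∀ g o {a h} → a ≢ h → 0 ℕ.< g h → (0 ℕ.< g a → α a ≤ β h) →
    potential (update g h (λ x → x ℕ.∸ 1)) (update o a (λ x → x ℕ.∸ 1)) ≤ potential g o
  potential-transfer g o {a} {h} a≢h gₕ>0 αₐ≤βₕ = begin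
    potential g₁ o₁         ≡⟨ ℚₚ.+-identityʳ _ ⟨
    potential g₁ o₁ + 0ℚ    ≤⟨ value-mono-≤-except a sameOffA atA ⟩
    potential g₁ o + β h    ≤⟨ value-mono-≤-except h sameOffH atH ⟩
    potential g o + 0ℚ      ≡⟨ ℚₚ.+-identityʳ _ ⟩
    potential g o           ∎
    where
    g₁ o₁ : Loads m
    g₁ = update g h (λ x → x ℕ.∸ 1)
    o₁ = update o a (λ x → x ℕ.∸ 1)
    sameOffA : ∀ j → j ≢ a → Dominated (λ j → g₁ j ℕ.∸ o₁ j) g₁ (λ j → g₁ j ℕ.∸ o j) g₁ j
    sameOffA j j≢a = ℕₚ.≤-reflexive (cong (g₁ j ℕ.∸_) (update-≢ o _ j≢a)) , ℕₚ.≤-refl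
    atA : weight a (g₁ a ℕ.∸ o₁ a) (g₁ a) + 0ℚ ≤ weight a (g₁ a ℕ.∸ o a) (g₁ a) + β h
    atA rewrite update-≡ o a (λ x → x ℕ.∸ 1) | update-≢ g (λ x → x ℕ.∸ 1) a≢h =
      weight-send-other a (g a) (o a) (β≥0 h) αₐ≤βₕ
    sameOffH : ∀ j → j ≢ h → Dominated (λ j → g₁ j ℕ.∸ o j) g₁ (λ j → g j ℕ.∸ o j) g j
    sameOffH j j≢h rewrite update-≢ g (λ x → x ℕ.∸ 1) j≢h = ℕₚ.≤-refl , ℕₚ.≤-refl
    atH : weight h (g₁ h ℕ.∸ o h) (g₁ h) + β h ≤ weight h (g h ℕ.∸ o h) (g h) + 0ℚ
    atH rewrite update-≡ g h (λ x → x ℕ.∸ 1) = weight-send-greedy h (g h) (o h) gₕ>0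

  send-step : ∀ g o d → Ok B o snd d →
    potential (step g snd (greedyChoice B g snd)) (step o snd d) ≤ potential g o
  send-step g o d ok with highest g | highest-correct g
  send-step g o idle _ | nothing | none _ = ℚₚ.≤-refl
  send-step g o idle _ | just h  | some _ _ = value-mono-≤ λ j →
    ℕₚ.∸-monoˡ-≤ (o j) (update-≤ g h (λ x → ℕₚ.m∸n≤m x 1) j) , update-≤ g h (λ x → ℕₚ.m∸n≤m x 1) j
  send-step g o (sendFrom a) _ | nothing | none g≡0 = value-mono-≤ emptyQueue
    where
    emptyQueue : ∀ j → Dominated (λ j → g j ℕ.∸ update o a (λ x → x ℕ.∸ 1) j) g (λ j → g j ℕ.∸ o j) g j
    emptyQueue j rewrite g≡0 j | ℕₚ.0∸n≡0 (update o a (λ x → x ℕ.∸ 1) j) = ℕ.z≤n , ℕₚ.≤-refl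
  send-step g o (sendFrom a) oₐ>0 | just h | some gₕ>0 maximal with a Finₚ.≟ h
  ... | yes refl = value-mono-≤ sameQueue
    where
    sameQueue : ∀ j → Dominated (λ j → update g a (λ x → x ℕ.∸ 1) j ℕ.∸ update o a (λ x → x ℕ.∸ 1) j)
                                (update g a (λ x → x ℕ.∸ 1)) (λ j → g j ℕ.∸ o j) g j
    sameQueue j with j Finₚ.≟ a
    ... | yes refl = ℕₚ.≤-reflexive (pred-∸-pred (g a) (o a) oₐ>0) , ℕₚ.m∸n≤m (g a) 1
    ... | no _     = ℕₚ.≤-refl , ℕₚ.≤-refl
  ... | no a≢h = potential-transfer g o a≢h gₕ>0 λ gₐ>0 → α≤β a h (Finₚ.≤∧≢⇒< (maximal a gₐ>0) a≢h)

  -- potential-step with each side merged into one value by value-+: a packet admitted by the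
  -- schedule counts with α only, a packet admitted by GREEDY with α + β.
  event-step : ∀ g o e d → Ok B o e d →
    let d* = greedyChoice B g e ; g′ = step g e d* ; o′ = step o e d in
    value (λ j → admitted e d j ℕ.+ (g′ j ℕ.∸ o′ j)) g′
      ≤ value (λ j → admitted e d* j ℕ.+ (g j ℕ.∸ o j)) (λ j → admitted e d* j ℕ.+ g j)
  event-step g o (arr k) = arrival-step g o k
  event-step g o snd     = send-step g o

  potential-step : ∀ g o e d → Ok B o e d →
    let d* = greedyChoice B g e in
    value (admitted e d) empty + potential (step g e d*) (step o e d)
      ≤ value (admitted e d*) (admitted e d*) + potential g o
  potential-step g o e d ok = begin
    value (admitted e d) empty + potential g′ o′
      ≡⟨ value-+ (admitted e d) empty (λ j → g′ j ℕ.∸ o′ j) g′ ⟩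
    value (λ j → admitted e d j ℕ.+ (g′ j ℕ.∸ o′ j)) g′
      ≤⟨ event-step g o e d ok ⟩
    value (λ j → admitted e d* j ℕ.+ (g j ℕ.∸ o j)) (λ j → admitted e d* j ℕ.+ g j)
      ≡⟨ value-+ (admitted e d*) (admitted e d*) (λ j → g j ℕ.∸ o j) g ⟨
    value (admitted e d*) (admitted e d*) + potential g o
      ∎
    where
    d* : Dec m
    d* = greedyChoice B g e
    g′ o′ : Loads m
    g′ = step g e d*
    o′ = step o e d

  potential-bound : ∀ es g o ds → Feasible B o es ds →
    let A = accepts es (greedy B g es) in value (accepts es ds) empty ≤ value A A + potential g o
  potential-bound [] g o [] _ = begin
    value empty empty                      ≡⟨ ℚₚ.+-identityʳ _ ⟨
    value empty empty + 0ℚ                 ≤⟨ ℚₚ.+-monoʳ-≤ (value empty empty) (value-nonNeg (λ k → g k ℕ.∸ o k) g) ⟩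
    value empty empty + potential g o      ∎
  potential-bound (e ∷ es) g o (d ∷ ds) (ok , feasible) rewrite greedy-∷ B g e es = begin
    value (accepts (e ∷ es) (d ∷ ds)) empty
      ≡⟨ value-cong {w = empty} {w′ = empty} (accepts-∷ e d es ds) (λ _ → refl) ⟩
    value (λ j → admitted e d j ℕ.+ accepts es ds j) empty
      ≡⟨ value-+ (admitted e d) empty (accepts es ds) empty ⟨
    value (admitted e d) empty + value (accepts es ds) empty
      ≤⟨ ℚₚ.+-monoʳ-≤ (value (admitted e d) empty) (potential-bound es g′ o′ ds feasible) ⟩
    value (admitted e d) empty + (value A A + potential g′ o′)
      ≡⟨ x∙yz≈y∙xz (value (admitted e d) empty) (value A A) (potential g′ o′) ⟩
    value A A + (value (admitted e d) empty + potential g′ o′)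
      ≤⟨ ℚₚ.+-monoʳ-≤ (value A A) (potential-step g o e d ok) ⟩
    value A A + (value (admitted e d*) (admitted e d*) + potential g o)
      ≡⟨ x∙yz≈yx∙z (value A A) (value (admitted e d*) (admitted e d*)) (potential g o) ⟩
    (value (admitted e d*) (admitted e d*) + value A A) + potential g o
      ≡⟨ cong (_+ potential g o) (value-+ (admitted e d*) (admitted e d*) A A) ⟩
    value (λ j → admitted e d* j ℕ.+ A j) (λ j → admitted e d* j ℕ.+ A j) + potential g o
      ≡⟨ cong (_+ potential g o) (value-cong accepts-greedy accepts-greedy) ⟨
    value (accepts (e ∷ es) (d* ∷ greedy B g′ es)) (accepts (e ∷ es) (d* ∷ greedy B g′ es)) + potential g o
      ∎
    where
    d* : Dec m
    d* = greedyChoice B g e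
    g′ o′ A : Loads m
    g′ = step g e d*
    o′ = step o e d
    A  = accepts es (greedy B g′ es)
    accepts-greedy : ∀ j → accepts (e ∷ es) (d* ∷ greedy B g′ es) j ≡ admitted e d* j ℕ.+ A j
    accepts-greedy = accepts-∷ e d* es (greedy B g′ es)

  greedy-bound : ∀ σ ds → Feasible B empty σ ds →
    let A = accepts σ (greedy B empty σ) in value (accepts σ ds) empty ≤ value A A
  greedy-bound σ ds feasible = begin
    value (accepts σ ds) empty      ≤⟨ potential-bound σ empty empty ds feasible ⟩
    value A A + potential empty empty ≡⟨ cong (value A A +_) value-zero ⟩
    value A A + 0ℚ                  ≡⟨ ℚₚ.+-identityʳ (value A A) ⟩
    value A A                       ∎
    where
    A : Loads m
    A = accepts σ (greedy B empty σ)

withoutTop : ∀ {n} → (Fin (suc n) → ℚ) → Fin (suc n) → ℚ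
withoutTop {ℕ.zero}  v fzero    = 0ℚ
withoutTop {suc n} v fzero    = v fzero
withoutTop {suc n} v (fsuc j) = withoutTop (v ∘ fsuc) j

shifted : ∀ {n} → (Fin (suc n) → ℚ) → Fin (suc n) → ℚ
shifted v fzero    = 0ℚ
shifted v (fsuc j) = v (inject₁ j)

withoutTop-fromℕ : ∀ n (v : Fin (suc n) → ℚ) → withoutTop v (fromℕ n) ≡ 0ℚ
withoutTop-fromℕ ℕ.zero    v = refl
withoutTop-fromℕ (suc n) v = withoutTop-fromℕ n (v ∘ fsuc)

withoutTop-inject₁ : ∀ {n} (v : Fin (suc n) → ℚ) j → withoutTop v (inject₁ j) ≡ v (inject₁ j)
withoutTop-inject₁ {suc n} v fzero    = refl
withoutTop-inject₁ {suc n} v (fsuc j) = withoutTop-inject₁ (v ∘ fsuc) j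

withoutTop-nonNeg : ∀ {n} {v : Fin (suc n) → ℚ} → (∀ i → 0ℚ ≤ v i) → ∀ j → 0ℚ ≤ withoutTop v j
withoutTop-nonNeg {ℕ.zero}  v≥0 fzero    = ℚₚ.≤-refl
withoutTop-nonNeg {suc n} v≥0 fzero    = v≥0 fzero
withoutTop-nonNeg {suc n} v≥0 (fsuc j) = withoutTop-nonNeg (v≥0 ∘ fsuc) j

withoutTop-≤ : ∀ {n} {v : Fin (suc n) → ℚ} → (∀ i → 0ℚ ≤ v i) → ∀ j → withoutTop v j ≤ v j
withoutTop-≤ {ℕ.zero}  v≥0 fzero    = v≥0 fzero
withoutTop-≤ {suc n} v≥0 fzero    = ℚₚ.≤-refl
withoutTop-≤ {suc n} v≥0 (fsuc j) = withoutTop-≤ (v≥0 ∘ fsuc) j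

shifted-nonNeg : ∀ {n} {v : Fin (suc n) → ℚ} → (∀ i → 0ℚ ≤ v i) → ∀ j → 0ℚ ≤ shifted v j
shifted-nonNeg v≥0 fzero    = ℚₚ.≤-refl
shifted-nonNeg v≥0 (fsuc j) = v≥0 (inject₁ j)

strictMono⇒mono : ∀ {n} {v : Fin n → ℚ} → (∀ i j → i <ᶠ j → v i < v j) → ∀ {i j} → i ≤ᶠ j → v i ≤ v j
strictMono⇒mono v-mono {i} {j} i≤j with ℕₚ.m≤n⇒m<n∨m≡n i≤j
... | inj₁ i<j = ℚₚ.<⇒≤ (v-mono i j i<j)
... | inj₂ i≡j = ℚₚ.≤-reflexive (cong _ (Finₚ.toℕ-injective i≡j))

withoutTop≤shifted : ∀ {n} {v : Fin (suc n) → ℚ} → (∀ i → 0ℚ ≤ v i) → (∀ i j → i <ᶠ j → v i < v j) →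
                     ∀ a h → a <ᶠ h → withoutTop v a ≤ shifted v h
withoutTop≤shifted {v = v} v≥0 v-mono a (fsuc h) a<1+h = ℚₚ.≤-trans (withoutTop-≤ v≥0 a)
  (strictMono⇒mono v-mono (subst (toℕ a ℕ.≤_) (sym (Finₚ.toℕ-inject₁ h)) (ℕ.s≤s⁻¹ a<1+h)))

module TheoremWeights (n : ℕ) (v : Fin (suc n) → ℚ) (v≥0 : ∀ i → 0ℚ ≤ v i) where

  open WeightedCounts (withoutTop v) (shifted v) (withoutTop-nonNeg v≥0) (shifted-nonNeg v≥0) public using (value)

  Σ-withoutTop : ∀ (x : Loads (suc n)) →
    Σ (suc n) (λ k → withoutTop v k * toℚ (x k)) ≡ Σ n (λ j → v (inject₁ j) * toℚ (x (inject₁ j)))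
  Σ-withoutTop x = trans (Σ-inject₁ n (λ k → withoutTop v k * toℚ (x k)) top≡0)
    (Σ-cong n λ j → cong (_* toℚ (x (inject₁ j))) (withoutTop-inject₁ v j))
    where
    top≡0 : withoutTop v (fromℕ n) * toℚ (x (fromℕ n)) ≡ 0ℚ
    top≡0 = trans (cong (_* toℚ (x (fromℕ n))) (withoutTop-fromℕ n v)) (ℚₚ.*-zeroˡ (toℚ (x (fromℕ n))))

  Σ-shifted : ∀ (x : Loads (suc n)) →
    Σ (suc n) (λ k → shifted v k * toℚ (x k)) ≡ Σ n (λ j → v (inject₁ j) * toℚ (x (fsuc j)))
  Σ-shifted x = trans (cong (_+ rest) (ℚₚ.*-zeroˡ (toℚ (x fzero)))) (ℚₚ.+-identityˡ rest)
    where
    rest : ℚ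
    rest = Σ n (λ j → v (inject₁ j) * toℚ (x (fsuc j)))

  value-firstOnly : ∀ x → value x empty ≡ Σ n (λ j → v (inject₁ j) * toℚ (x (inject₁ j)))
  value-firstOnly x = trans (Σ-cong (suc n) λ k → drop (withoutTop v k) (shifted v k) (toℚ (x k))) (Σ-withoutTop x)
    where
    drop : ∀ a b t → a * t + b * 0ℚ ≡ a * t
    drop = solve-∀ ℚ-ring

  value-diagonal : ∀ x → value x x ≡ Σ n (λ j → v (inject₁ j) * toℚ (x (inject₁ j)))
                                    + Σ n (λ j → v (inject₁ j) * toℚ (x (fsuc j)))
  value-diagonal x = trans (Σ-distrib-+ (suc n) (λ k → withoutTop v k * toℚ (x k)) (λ k → shifted v k * toℚ (x k)))
    (cong₂ _+_ (Σ-withoutTop x) (Σ-shifted x))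

lemma3 : (n B : ℕ) (v : Fin (suc n) → ℚ)
    → (∀ i → 0ℚ ≤ v i)
    → (∀ i j → i <ᶠ j → v i < v j)
    → (σ : List (Event (suc n)))
    → (opt : List (Dec (suc n)))
    → Feasible B empty σ opt
    → Diligent B empty σ opt
    → (∀ ds → Feasible B empty σ ds → benefit v σ ds ≤ benefit v σ opt)
    → Σ n (λ j → v (inject₁ j) * (toℚ (accepted (inject₁ j) σ opt)
                                   - toℚ (accepted (inject₁ j) σ (greedy B empty σ))))
      ≤ Σ n (λ j → v (inject₁ j) * toℚ (accepted (fsuc j) σ (greedy B empty σ)))
lemma3 n B v v≥0 v-mono σ opt feasible _ _ = +-cancelʳ-≤ (S A inject₁) (begin
  Σ n (λ j → v′ j * (toℚ (A* (inject₁ j)) - toℚ (A (inject₁ j)))) + S A inject₁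
                          ≡⟨ Σ[f*[a-b]]+Σ[f*b]≡Σ[f*a] n v′ (λ j → toℚ (A* (inject₁ j))) (λ j → toℚ (A (inject₁ j))) ⟩
  S A* inject₁            ≡⟨ value-firstOnly A* ⟨
  value A* empty          ≤⟨ greedy-bound σ opt feasible ⟩
  value A A               ≡⟨ value-diagonal A ⟩
  S A inject₁ + S A fsuc  ≡⟨ ℚₚ.+-comm (S A inject₁) (S A fsuc) ⟩
  S A fsuc + S A inject₁  ∎)
  where
  open TheoremWeights n v v≥0
  open GreedyPotential B (withoutTop v) (shifted v) (withoutTop-nonNeg v≥0) (shifted-nonNeg v≥0)
         (withoutTop≤shifted v≥0 v-mono) using (greedy-bound)
  v′ : Fin n → ℚ
  v′ j = v (inject₁ j)
  A* A : Loads (suc n)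
  A* = accepts σ opt
  A  = accepts σ (greedy B empty σ)
  S : Loads (suc n) → (Fin n → Fin (suc n)) → ℚ
  S x ι = Σ n (λ j → v′ j * toℚ (x (ι j)))
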